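{- Let $T$ be a tree of order at least four with no vertex of degree two, and let $G$ be its Halin graph. If $T$ has no vertex of degree $3$ and $T$ has at least $6$ leaves, then $D(G)\leq 2$.
   Context: Given a tree $T$ with at least four vertices and no vertex of degree two, embedded in the plane without edge crossings, the Halin graph of $T$ is obtained from $T$ by adding a cycle through all leaves of $T$, connecting them in their clockwise order in the embedding. A vertex labeling $\phi:V(G)\to\{1,\dots,r\}$ is $r$-distinguishing if the only automorphism of $G$ preserving all vertex labels is the identity. The distinguishing number $D(G)$ is the least $r$ such that $G$ has an $r$-distinguishing vertex labeling. -}

module Defs where

open import Data.Nat using (ℕ; zero; suc; _≤_)
open import Data.Nat.Properties using (_≟_)
open import Data.Fin using (Fin; toℕ)
open import Data.Fin.Permutation using (Permutation′; _⟨$⟩ʳ_)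
open import Data.List using (List; []; _∷_; _++_; length; filter)
open import Data.List.Membership.Propositional using (_∈_)
open import Data.List.Base using (allFin)
open import Data.Product using (_×_; _,_; proj₁; proj₂; Σ; ∃)
open import Data.Sum using (_⊎_)
open import Relation.Binary.PropositionalEquality using (_≡_)
open import Relation.Nullary using (¬_)
open import Relation.Nullary.Decidable using (⌊_⌋)
open import Data.Bool using (Bool; true; false; _∨_; T)
open import Data.Bool.Properties using (T?)
open import Function.Bundles using (_⇔_)

-- Plane (embedded) trees, encoded combinatorially as rooted ordered trees:
-- choosing a root and listing children in clockwise order determines the
-- embedding (rotation system), and every plane tree arises this way.

data PTree : Set where
  node : List PTree → PTree

-- Preorder numbering of vertices.  `go k t` numbers the vertices of `t`
-- starting at `k`, and returns (next free number, edges of t, leaves of t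
-- below-root in clockwise (left-to-right) order).
mutual
  go : ℕ → PTree → ℕ × List (ℕ × ℕ) × List ℕ
  go k (node []) = suc k , [] , (k ∷ [])
  go k (node (t ∷ ts)) = goF k (suc k) (t ∷ ts)

  goF : ℕ → ℕ → List PTree → ℕ × List (ℕ × ℕ) × List ℕ
  goF p k [] = k , [] , []
  goF p k (t ∷ ts) with go k t
  ... | k₁ , es₁ , ls₁ with goF p k₁ ts
  ...   | k₂ , es₂ , ls₂ = k₂ , ((p , k) ∷ es₁ ++ es₂) , (ls₁ ++ ls₂)

order : PTree → ℕ
order T = proj₁ (go 0 T)

-- edges of T (pairs of vertex numbers, root is 0)
treeEdges : PTree → List (ℕ × ℕ)
treeEdges T = proj₁ (proj₂ (go 0 T))

-- The leaves of T in clockwise order.  The root (vertex 0) is itself a leaf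
-- of T iff it has exactly one child; in that case it comes first.
leafOrder : PTree → List ℕ
leafOrder (node (t ∷ [])) = 0 ∷ proj₂ (proj₂ (go 0 (node (t ∷ []))))
leafOrder T = proj₂ (proj₂ (go 0 T))

cycleEdges : List ℕ → List (ℕ × ℕ)
cycleEdges [] = []
cycleEdges (l ∷ ls) = aux l (l ∷ ls)
  where
  aux : ℕ → List ℕ → List (ℕ × ℕ)
  aux first [] = []
  aux first (x ∷ []) = (x , first) ∷ []
  aux first (x ∷ y ∷ xs) = (x , y) ∷ aux first (y ∷ xs)

halinEdges : PTree → List (ℕ × ℕ)
halinEdges T = treeEdges T ++ cycleEdges (leafOrder T)

Adj : (n : ℕ) → List (ℕ × ℕ) → Fin n → Fin n → Set
Adj n E u v = ((toℕ u , toℕ v) ∈ E) ⊎ ((toℕ v , toℕ u) ∈ E)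

incident : ℕ → ℕ × ℕ → Bool
incident v (a , b) = ⌊ a ≟ v ⌋ ∨ ⌊ b ≟ v ⌋

degree : List (ℕ × ℕ) → ℕ → ℕ
degree E v = length (filter (λ e → T? (incident v e)) E)

degT : (T : PTree) → Fin (order T) → ℕ
degT T v = degree (treeEdges T) (toℕ v)

numLeaves : PTree → ℕ
numLeaves T = length (filter (λ v → degT T v ≟ 1) (allFin (order T)))

IsAutomorphism : (n : ℕ) → List (ℕ × ℕ) → Permutation′ n → Set
IsAutomorphism n E π =
  ∀ u v → Adj n E u v ⇔ Adj n E (π ⟨$⟩ʳ u) (π ⟨$⟩ʳ v)

IsDistinguishing : (n : ℕ) → List (ℕ × ℕ) → (r : ℕ) → (Fin n → Fin r) → Set
IsDistinguishing n E r φ =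
  ∀ (π : Permutation′ n) → IsAutomorphism n E π →
  (∀ v → φ (π ⟨$⟩ʳ v) ≡ φ v) → ∀ v → π ⟨$⟩ʳ v ≡ v

DistNumberAtMost : (n : ℕ) → List (ℕ × ℕ) → ℕ → Set
DistNumberAtMost n E k =
  Σ ℕ λ r → r ≤ k × Σ (Fin n → Fin r) λ φ → IsDistinguishing n E r φ

module Submission where

-- Let l₀ l₁ … l_{m−1} (m ≥ 6) be the leaf cycle and colour
-- l₀, l₁, l₃ with colour 1, every other vertex with colour 0.  Internal
-- vertices of G have ≥ 4 distinct neighbours (their tree degree is ≥ 4),
-- whereas a leaf has only three (parent, cycle successor, cycle predecessor);
-- so every automorphism σ maps leaves to leaves.  If σ preserves the colours,
-- it permutes {l₀, l₁, l₃}; l₃ is the only coloured vertex with no coloured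
-- neighbour, so σ l₃ = l₃, then σ l₁ = l₁ (else l₂'s image would be a leaf
-- adjacent to both l₀ and l₃) and σ l₀ = l₀.  Fixing two consecutive leaves
-- fixes the whole leaf cycle, and fixing all leaves fixes every vertex
-- (downwards along the tree, since each internal vertex is the unique parent
-- of some child).

open import Data.Bool using (T)
open import Data.Bool.Properties using (T?)
open import Data.Empty using (⊥; ⊥-elim)
open import Data.Fin using (Fin; toℕ; fromℕ<) renaming (zero to fzero; suc to fsuc)
import Data.Fin as Fin
open import Data.Fin.Induction using (>-wellFounded)
open import Data.Fin.Permutation using (Permutation′; _⟨$⟩ʳ_; _⟨$⟩ˡ_; inverseˡ; inverseʳ)
open import Data.Fin.Properties using (toℕ-injective; toℕ<n; toℕ-fromℕ<; pigeonhole)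
open import Data.List using (List; []; _∷_; _++_; length; filter; map; drop; allFin)
open import Data.List.Membership.Propositional using (_∈_; _∉_)
open import Data.List.Membership.Propositional.Properties
  using (∈-++⁺ˡ; ∈-++⁺ʳ; ∈-++⁻; ∈-map⁺; ∈-map⁻; ∈-filter⁺; ∈-filter⁻)
open import Data.List.Properties using (map-++; length-map)
open import Data.List.Relation.Unary.All using (All; []; _∷_)
import Data.List.Relation.Unary.All as All
open import Data.List.Relation.Unary.All.Properties using (All¬⇒¬Any; ¬Any⇒All¬)
open import Data.List.Relation.Unary.AllPairs using ([]; _∷_)
import Data.List.Relation.Unary.AllPairs.Properties as AllPairs
open import Data.List.Relation.Unary.Any using (here; there; index)
open import Data.List.Relation.Unary.Unique.Propositional using (Unique)
import Data.List.Relation.Unary.Unique.Propositional.Properties as Unique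
open import Data.Nat using (ℕ; zero; suc; _≤_; _<_; z≤n; s≤s; z<s; _≟_)
open import Data.Nat.Properties
open import Data.List.Membership.DecPropositional _≟_ using (_∈?_)
open import Data.Product using (_×_; _,_; proj₁; proj₂; Σ; ∃; uncurry)
open import Data.Sum using (_⊎_; inj₁; inj₂; [_,_]′)
open import Data.Vec using (Vec; lookup; []; _∷_)
open import Data.Vec.Relation.Unary.All using ([]; _∷_)
open import Data.Vec.Relation.Unary.AllPairs using ([]; _∷_)
open import Data.Vec.Relation.Unary.Unique.Propositional using () renaming (Unique to UniqueVec)
open import Data.Vec.Relation.Unary.Unique.Propositional.Properties using (lookup-injective)
open import Function using (_∘_)
open import Function.Bundles using (Equivalence)
import Induction.WellFounded as WF
open import Relation.Binary.PropositionalEquality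
open import Relation.Nullary using (¬_; Dec; yes; no; contradiction)
open import Relation.Nullary.Decidable using (_⊎-dec_)
open import Relation.Unary using (Pred; Decidable)

open import Defs

head∉tail : ∀ {A : Set} {x : A} {xs} → Unique (x ∷ xs) → x ∉ xs
head∉tail (x∉ ∷ _) = All¬⇒¬Any x∉

unique-distinct : ∀ {A : Set} {xs : List A} {x y : A} → Unique xs →
  (p : x ∈ xs) (q : y ∈ xs) → index p ≢ index q → x ≢ y
unique-distinct _ (here refl) (here refl) ne _ = ne refl
unique-distinct u (here refl) (there q) _ refl = head∉tail u q
unique-distinct u (there p) (here refl) _ refl = head∉tail u p
unique-distinct (_ ∷ u) (there p) (there q) ne = unique-distinct u p q (ne ∘ cong fsuc)

distinct-members⇒2≤length : ∀ {A : Set} {x y : A} {ys} → x ∈ ys → y ∈ ys → x ≢ y → 2 ≤ length ys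
distinct-members⇒2≤length {ys = _ ∷ []} (here refl) (here refl) x≢y = ⊥-elim (x≢y refl)
distinct-members⇒2≤length {ys = _ ∷ _ ∷ _} _ _ _ = s≤s (s≤s z≤n)

remove : ∀ {A : Set} {x : A} ys → x ∈ ys → List A
remove (_ ∷ ys) (here _) = ys
remove (y ∷ ys) (there m) = y ∷ remove ys m

length-remove : ∀ {A : Set} {x : A} ys (m : x ∈ ys) → suc (length (remove ys m)) ≡ length ys
length-remove (_ ∷ ys) (here _) = refl
length-remove (_ ∷ ys) (there m) = cong suc (length-remove ys m)

∈-remove : ∀ {A : Set} {x z : A} ys (m : x ∈ ys) → z ∈ ys → z ≢ x → z ∈ remove ys m
∈-remove (_ ∷ ys) (here refl) (here refl) z≢x = ⊥-elim (z≢x refl)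
∈-remove (_ ∷ ys) (here refl) (there mz) _ = mz
∈-remove (_ ∷ ys) (there m) (here refl) _ = here refl
∈-remove (_ ∷ ys) (there m) (there mz) z≢x = there (∈-remove ys m mz z≢x)

unique⊆⇒length≤ : ∀ {A : Set} (xs ys : List A) → Unique xs →
  (∀ {z} → z ∈ xs → z ∈ ys) → length xs ≤ length ys
unique⊆⇒length≤ [] ys _ _ = z≤n
unique⊆⇒length≤ (x ∷ xs) ys u@(_ ∷ u′) xs⊆ys =
  subst (suc (length xs) ≤_) (length-remove ys x∈ys)
    (s≤s (unique⊆⇒length≤ xs (remove ys x∈ys) u′ xs⊆rest))
  where
  x∈ys : x ∈ ys
  x∈ys = xs⊆ys (here refl)
  xs⊆rest : ∀ {z} → z ∈ xs → z ∈ remove ys x∈ys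
  xs⊆rest {z} z∈xs = ∈-remove ys x∈ys (xs⊆ys (there z∈xs)) λ { refl → head∉tail u z∈xs }

proj₂-determines : ∀ {A B : Set} (es : List (A × B)) → Unique (map proj₂ es) →
  ∀ {x y} → x ∈ es → y ∈ es → proj₂ x ≡ proj₂ y → x ≡ y
proj₂-determines (_ ∷ es) _ (here refl) (here refl) _ = refl
proj₂-determines (_ ∷ es) u (here refl) (there my) eq =
  ⊥-elim (head∉tail u (subst (_∈ map proj₂ es) (sym eq) (∈-map⁺ proj₂ my)))
proj₂-determines (_ ∷ es) u (there mx) (here refl) eq =
  ⊥-elim (head∉tail u (subst (_∈ map proj₂ es) eq (∈-map⁺ proj₂ mx)))
proj₂-determines (_ ∷ es) (_ ∷ u) (there mx) (there my) eq = proj₂-determines es u mx my eq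

unique-proj₂-filter : ∀ {A B : Set} {p} {P : Pred (A × B) p} (P? : Decidable P) (es : List (A × B)) →
  Unique (map proj₂ es) → Unique (map proj₂ (filter P? es))
unique-proj₂-filter P? es u = AllPairs.map⁺ (AllPairs.filter⁺ P? (AllPairs.map⁻ u))

unique-map-on : ∀ {A B : Set} (f : A → B) {xs : List A} →
  (∀ {x y} → x ∈ xs → y ∈ xs → f x ≡ f y → x ≡ y) → Unique xs → Unique (map f xs)
unique-map-on f {[]} _ [] = []
unique-map-on f {x ∷ xs} inj u@(_ ∷ u′) =
  ¬Any⇒All¬ (map f xs) fx∉ ∷ unique-map-on f (λ mx my → inj (there mx) (there my)) u′
  where
  fx∉ : f x ∉ map f xs
  fx∉ m with ∈-map⁻ f m
  ... | y , y∈xs , fx≡fy = head∉tail u (subst (_∈ xs) (sym (inj (here refl) (there y∈xs) fx≡fy)) y∈xs)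

Numbering : Set
Numbering = ℕ × List (ℕ × ℕ) × List ℕ

nextFree : Numbering → ℕ
nextFree = proj₁

edgesOf : Numbering → List (ℕ × ℕ)
edgesOf r = proj₁ (proj₂ r)

leavesOf : Numbering → List ℕ
leavesOf r = proj₂ (proj₂ r)

record SubtreeInv (k : ℕ) (r : Numbering) : Set where
  field
    root<next        : k < nextFree r
    edge-bounds      : ∀ {a c} → (a , c) ∈ edgesOf r → k ≤ a × a < c × c < nextFree r
    parents-unique   : Unique (map proj₂ (edgesOf r))
    has-parent       : ∀ c → k < c → c < nextFree r → ∃ λ a → (a , c) ∈ edgesOf r
    leaf-bounds      : ∀ {v} → v ∈ leavesOf r → k ≤ v × v < nextFree r
    leaves-unique    : Unique (leavesOf r)
    leaf-childless   : ∀ {v c} → v ∈ leavesOf r → (v , c) ∈ edgesOf r → ⊥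
    leaf-or-parent   : ∀ v → k ≤ v → v < nextFree r → v ∈ leavesOf r ⊎ ∃ λ c → (v , c) ∈ edgesOf r

record ForestInv (p k : ℕ) (r : Numbering) : Set where
  field
    k≤next           : k ≤ nextFree r
    edge-bounds      : ∀ {a c} → (a , c) ∈ edgesOf r →
                       (a ≡ p ⊎ k ≤ a) × a < c × k ≤ c × c < nextFree r
    parents-unique   : Unique (map proj₂ (edgesOf r))
    has-parent       : ∀ c → k ≤ c → c < nextFree r → ∃ λ a → (a , c) ∈ edgesOf r
    leaf-bounds      : ∀ {v} → v ∈ leavesOf r → k ≤ v × v < nextFree r
    leaves-unique    : Unique (leavesOf r)
    leaf-childless   : ∀ {v c} → v ∈ leavesOf r → (v , c) ∈ edgesOf r → ⊥
    leaf-or-parent   : ∀ v → k ≤ v → v < nextFree r → v ∈ leavesOf r ⊎ ∃ λ c → (v , c) ∈ edgesOf r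

separated : ∀ {xs ys : List ℕ} {b} → (∀ {x} → x ∈ xs → x < b) → (∀ {y} → y ∈ ys → b ≤ y) →
  ∀ {z} → z ∈ xs × z ∈ ys → ⊥
separated below above (z∈xs , z∈ys) = <⇒≱ (below z∈xs) (above z∈ys)

emptyForestInv : ∀ p k → ForestInv p k (k , [] , [])
emptyForestInv p k = record
  { k≤next = ≤-refl ; edge-bounds = λ () ; parents-unique = []
  ; has-parent = λ c k≤c c<k → ⊥-elim (<⇒≱ c<k k≤c)
  ; leaf-bounds = λ () ; leaves-unique = [] ; leaf-childless = λ ()
  ; leaf-or-parent = λ v k≤v v<k → ⊥-elim (<⇒≱ v<k k≤v) }

leafInv : ∀ k → SubtreeInv k (suc k , [] , k ∷ [])
leafInv k = record
  { root<next = ≤-refl ; edge-bounds = λ () ; parents-unique = []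
  ; has-parent = λ c k<c c<sk → ⊥-elim (<⇒≱ c<sk k<c)
  ; leaf-bounds = λ { (here refl) → ≤-refl , ≤-refl }
  ; leaves-unique = [] ∷ []
  ; leaf-childless = λ _ ()
  ; leaf-or-parent = λ v k≤v v<sk → inj₁ (here (≤-antisym (≤-pred v<sk) k≤v)) }

module ConsTree (p k : ℕ) (r₁ r₂ : Numbering) (p<k : p < k)
                (I : SubtreeInv k r₁) (J : ForestInv p (nextFree r₁) r₂) where
  private
    module I = SubtreeInv I
    module J = ForestInv J
    k₁ k₂ : ℕ
    k₁ = nextFree r₁
    k₂ = nextFree r₂
    es₁ es₂ : List (ℕ × ℕ)
    es₁ = edgesOf r₁
    es₂ = edgesOf r₂
    ls₁ ls₂ : List ℕ
    ls₁ = leavesOf r₁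
    ls₂ = leavesOf r₂

  merged : Numbering
  merged = k₂ , ((p , k) ∷ es₁ ++ es₂) , (ls₁ ++ ls₂)

  k≤k₂ : k ≤ k₂
  k≤k₂ = ≤-trans (<⇒≤ I.root<next) J.k≤next

  edge-bounds : ∀ {a c} → (a , c) ∈ edgesOf merged → (a ≡ p ⊎ k ≤ a) × a < c × k ≤ c × c < k₂
  edge-bounds (here refl) = inj₁ refl , p<k , ≤-refl , <-≤-trans I.root<next J.k≤next
  edge-bounds (there m) with ∈-++⁻ es₁ m
  ... | inj₁ m₁ = let (k≤a , a<c , c<k₁) = I.edge-bounds m₁ in
        inj₂ k≤a , a<c , ≤-trans k≤a (<⇒≤ a<c) , <-≤-trans c<k₁ J.k≤next
  ... | inj₂ m₂ = let (a-src , a<c , k₁≤c , c<k₂) = J.edge-bounds m₂ in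
        [ inj₁ , (λ k₁≤a → inj₂ (≤-trans (<⇒≤ I.root<next) k₁≤a)) ]′ a-src ,
        a<c , ≤-trans (<⇒≤ I.root<next) k₁≤c , c<k₂

  children₁-bounds : ∀ {c} → c ∈ map proj₂ es₁ → k < c × c < k₁
  children₁-bounds m with ∈-map⁻ proj₂ m
  ... | _ , m₁ , refl = let (k≤a , a<c , c<k₁) = I.edge-bounds m₁ in ≤-<-trans k≤a a<c , c<k₁

  children₂-bound : ∀ {c} → c ∈ map proj₂ es₂ → k₁ ≤ c
  children₂-bound m with ∈-map⁻ proj₂ m
  ... | _ , m₂ , refl = proj₁ (proj₂ (proj₂ (J.edge-bounds m₂)))

  parents-unique : Unique (map proj₂ (edgesOf merged))
  parents-unique rewrite map-++ proj₂ es₁ es₂ =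
    ¬Any⇒All¬ _ k-new ∷ Unique.++⁺ I.parents-unique J.parents-unique
                           (separated (proj₂ ∘ children₁-bounds) children₂-bound)
    where
    k-new : k ∉ map proj₂ es₁ ++ map proj₂ es₂
    k-new m with ∈-++⁻ (map proj₂ es₁) m
    ... | inj₁ m₁ = <-irrefl refl (proj₁ (children₁-bounds m₁))
    ... | inj₂ m₂ = <⇒≱ I.root<next (children₂-bound m₂)

  has-parent : ∀ c → k ≤ c → c < k₂ → ∃ λ a → (a , c) ∈ edgesOf merged
  has-parent c k≤c c<k₂ with m≤n⇒m<n∨m≡n k≤c
  ... | inj₂ refl = p , here refl
  ... | inj₁ k<c with c <? k₁
  ...   | yes c<k₁ = let (a , m) = I.has-parent c k<c c<k₁ in a , there (∈-++⁺ˡ m)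
  ...   | no c≮k₁ = let (a , m) = J.has-parent c (≮⇒≥ c≮k₁) c<k₂ in a , there (∈-++⁺ʳ es₁ m)

  leaf-bounds : ∀ {v} → v ∈ ls₁ ++ ls₂ → k ≤ v × v < k₂
  leaf-bounds m with ∈-++⁻ ls₁ m
  ... | inj₁ m₁ = let (k≤v , v<k₁) = I.leaf-bounds m₁ in k≤v , <-≤-trans v<k₁ J.k≤next
  ... | inj₂ m₂ = let (k₁≤v , v<k₂) = J.leaf-bounds m₂ in ≤-trans (<⇒≤ I.root<next) k₁≤v , v<k₂

  leaves-unique : Unique (ls₁ ++ ls₂)
  leaves-unique = Unique.++⁺ I.leaves-unique J.leaves-unique
    (separated (proj₂ ∘ I.leaf-bounds) (proj₁ ∘ J.leaf-bounds))

  leaf-childless : ∀ {v c} → v ∈ ls₁ ++ ls₂ → (v , c) ∈ edgesOf merged → ⊥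
  leaf-childless v∈ (here refl) = <⇒≱ p<k (proj₁ (leaf-bounds v∈))
  leaf-childless v∈ (there e) with ∈-++⁻ ls₁ v∈ | ∈-++⁻ es₁ e
  ... | inj₁ v₁ | inj₁ e₁ = I.leaf-childless v₁ e₁
  ... | inj₁ v₁ | inj₂ e₂ = [ (λ { refl → <⇒≱ p<k (proj₁ (I.leaf-bounds v₁)) })
                            , <⇒≱ (proj₂ (I.leaf-bounds v₁)) ]′ (proj₁ (J.edge-bounds e₂))
  ... | inj₂ v₂ | inj₁ e₁ = let (_ , v<c , c<k₁) = I.edge-bounds e₁ in
                            <⇒≱ (<-trans v<c c<k₁) (proj₁ (J.leaf-bounds v₂))
  ... | inj₂ v₂ | inj₂ e₂ = J.leaf-childless v₂ e₂

  leaf-or-parent : ∀ v → k ≤ v → v < k₂ → v ∈ ls₁ ++ ls₂ ⊎ ∃ λ c → (v , c) ∈ edgesOf merged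
  leaf-or-parent v k≤v v<k₂ with v <? k₁
  ... | yes v<k₁ = [ inj₁ ∘ ∈-++⁺ˡ , (λ { (c , m) → inj₂ (c , there (∈-++⁺ˡ m)) }) ]′
                     (I.leaf-or-parent v k≤v v<k₁)
  ... | no v≮k₁ = [ inj₁ ∘ ∈-++⁺ʳ ls₁ , (λ { (c , m) → inj₂ (c , there (∈-++⁺ʳ es₁ m)) }) ]′
                     (J.leaf-or-parent v (≮⇒≥ v≮k₁) v<k₂)

  forestInv : ForestInv p k merged
  forestInv = record
    { k≤next = k≤k₂ ; edge-bounds = edge-bounds ; parents-unique = parents-unique
    ; has-parent = has-parent ; leaf-bounds = leaf-bounds ; leaves-unique = leaves-unique
    ; leaf-childless = leaf-childless ; leaf-or-parent = leaf-or-parent }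

firstChildEdge : ∀ p k t ts → (p , k) ∈ edgesOf (goF p k (t ∷ ts))
firstChildEdge p k t ts with go k t
... | r₁ with goF p (nextFree r₁) ts
...   | _ = here refl

forest⇒subtree : ∀ {k r} → ForestInv k (suc k) r → (k , suc k) ∈ edgesOf r → SubtreeInv k r
forest⇒subtree {k} {r} J first = record
  { root<next = J.k≤next
  ; edge-bounds = λ m → let (a-src , a<c , _ , c<next) = J.edge-bounds m in
      [ ≤-reflexive ∘ sym , <⇒≤ ]′ a-src , a<c , c<next
  ; parents-unique = J.parents-unique
  ; has-parent = J.has-parent
  ; leaf-bounds = λ m → let (k<v , v<next) = J.leaf-bounds m in <⇒≤ k<v , v<next
  ; leaves-unique = J.leaves-unique
  ; leaf-childless = J.leaf-childless
  ; leaf-or-parent = leaf-or-parent }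
  where
  module J = ForestInv J
  leaf-or-parent : ∀ v → k ≤ v → v < nextFree r → v ∈ leavesOf r ⊎ ∃ λ c → (v , c) ∈ edgesOf r
  leaf-or-parent v k≤v v<next with m≤n⇒m<n∨m≡n k≤v
  ... | inj₂ refl = inj₂ (suc k , first)
  ... | inj₁ k<v = J.leaf-or-parent v k<v v<next

mutual
  subtreeInv : ∀ k t → SubtreeInv k (go k t)
  subtreeInv k (node []) = leafInv k
  subtreeInv k (node (t ∷ ts)) =
    forest⇒subtree (forestInv k (suc k) (t ∷ ts) ≤-refl) (firstChildEdge k (suc k) t ts)

  forestInv : ∀ p k ts → p < k → ForestInv p k (goF p k ts)
  forestInv p k [] p<k = emptyForestInv p k
  forestInv p k (t ∷ ts) p<k with go k t | subtreeInv k t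
  ... | r₁ | I with goF p (nextFree r₁) ts
                  | forestInv p (nextFree r₁) ts (<-trans p<k (<-≤-trans (n<1+n k) (SubtreeInv.root<next I)))
  ...   | r₂ | J = ConsTree.forestInv p k r₁ r₂ p<k I J

secondChildEdge : ∀ p k t u us → ∃ λ c → k < c × (p , c) ∈ edgesOf (goF p k (t ∷ u ∷ us))
secondChildEdge p k t u us with go k t | subtreeInv k t
... | r₁ | I with goF p (nextFree r₁) (u ∷ us) | firstChildEdge p (nextFree r₁) u us
...   | _ | first = nextFree r₁ , SubtreeInv.root<next I , there (∈-++⁺ʳ (edgesOf r₁) first)

onlyChild : ∀ p k t → p < k → ∀ {c} → (p , c) ∈ edgesOf (goF p k (t ∷ [])) → c ≡ k
onlyChild p k t p<k m with go k t | subtreeInv k t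
... | r₁ | I with m
... | here refl = refl
... | there m′ with ∈-++⁻ (edgesOf r₁) m′
...   | inj₁ m₁ = ⊥-elim (<⇒≱ p<k (proj₁ (SubtreeInv.edge-bounds I m₁)))
...   | inj₂ ()

TreeAdj : List (ℕ × ℕ) → ℕ → ℕ → Set
TreeAdj TE v w = (v , w) ∈ TE ⊎ (w , v) ∈ TE

-- The properties of a tree on the labels 0 … n−1 (edges TE, directed from
-- parent to child) and of its list L of leaves used by the argument below.
record HalinFrame (n : ℕ) (TE : List (ℕ × ℕ)) (L : List ℕ) : Set where
  field
    edge-bounds      : ∀ {a c} → (a , c) ∈ TE → a < c × c < n
    parents-unique   : Unique (map proj₂ TE)
    leaf-bound       : ∀ {v} → v ∈ L → v < n
    leaves-unique    : Unique L
    internal-child   : ∀ v → v < n → v ∉ L → ∃ λ c → (v , c) ∈ TE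
    internal-degree  : ∀ v → v < n → v ∉ L → 2 ≤ degree TE v
    leaf-tree-nbr    : ∀ {v w w′} → v ∈ L → TreeAdj TE v w → TreeAdj TE v w′ → w ≡ w′
    no-leaf-leaf     : ∀ {a b} → (a , b) ∈ TE → a ∈ L → b ∈ L → ⊥

incident-src : ∀ v b → T (incident v (v , b))
incident-src v b with v ≟ v
... | yes _ = _
... | no v≢v = ⊥-elim (v≢v refl)

incident-tgt : ∀ a v → T (incident v (a , v))
incident-tgt a v with a ≟ v
... | yes _ = _
... | no _ with v ≟ v
...   | yes _ = _
...   | no v≢v = ⊥-elim (v≢v refl)

incident-cases : ∀ {v a b} → T (incident v (a , b)) → a ≡ v ⊎ b ≡ v
incident-cases {v} {a} {b} i with a ≟ v
... | yes a≡v = inj₁ a≡v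
... | no _ with b ≟ v
...   | yes b≡v = inj₂ b≡v
...   | no _ = ⊥-elim i

two-edges⇒2≤degree : ∀ TE v {e₁ e₂} → e₁ ∈ TE → e₂ ∈ TE →
  T (incident v e₁) → T (incident v e₂) → e₁ ≢ e₂ → 2 ≤ degree TE v
two-edges⇒2≤degree TE v m₁ m₂ i₁ i₂ =
  distinct-members⇒2≤length (∈-filter⁺ (T? ∘ incident v) m₁ i₁) (∈-filter⁺ (T? ∘ incident v) m₂ i₂)

module BelowRoot (ts : List PTree) where
  r : Numbering
  r = goF 0 1 ts
  n : ℕ
  n = nextFree r
  es : List (ℕ × ℕ)
  es = edgesOf r
  ls : List ℕ
  ls = leavesOf r
  inv : ForestInv 0 1 r
  inv = forestInv 0 1 ts z<s
  module Inv = ForestInv inv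

  edge-bounds : ∀ {a c} → (a , c) ∈ es → a < c × c < n
  edge-bounds m = let (_ , a<c , _ , c<n) = Inv.edge-bounds m in a<c , c<n

  internal-child : ∀ v → suc v < n → suc v ∉ ls → ∃ λ c → (suc v , c) ∈ es
  internal-child v v<n v∉ls with Inv.leaf-or-parent (suc v) (s≤s z≤n) v<n
  ... | inj₁ v∈ls = ⊥-elim (v∉ls v∈ls)
  ... | inj₂ child = child

  -- an internal non-root vertex has a parent edge and a child edge
  internal-degree : ∀ v → suc v < n → suc v ∉ ls → 2 ≤ degree es (suc v)
  internal-degree v v<n v∉ls with Inv.has-parent (suc v) (s≤s z≤n) v<n | internal-child v v<n v∉ls
  ... | a , ma | c , mc = two-edges⇒2≤degree es (suc v) ma mc (incident-tgt a (suc v)) (incident-src (suc v) c)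
        (λ e → <-irrefl (cong proj₁ e) (proj₁ (edge-bounds ma)))

  -- a leaf's only tree neighbour is its parent
  leaf-tree-nbr : ∀ {v w w′} → v ∈ ls → TreeAdj es v w → TreeAdj es v w′ → w ≡ w′
  leaf-tree-nbr v∈ls (inj₁ m) _ = ⊥-elim (Inv.leaf-childless v∈ls m)
  leaf-tree-nbr v∈ls (inj₂ _) (inj₁ m) = ⊥-elim (Inv.leaf-childless v∈ls m)
  leaf-tree-nbr v∈ls (inj₂ m) (inj₂ m′) = cong proj₁ (proj₂-determines es Inv.parents-unique m m′ refl)

-- If the root has at least two children, it is internal and the leaf cycle
-- runs through the leaves of the subtrees.
frame-branchingRoot : ∀ t u us → let open BelowRoot (t ∷ u ∷ us) in HalinFrame n es ls
frame-branchingRoot t u us = record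
  { edge-bounds = edge-bounds
  ; parents-unique = Inv.parents-unique
  ; leaf-bound = proj₂ ∘ Inv.leaf-bounds
  ; leaves-unique = Inv.leaves-unique
  ; internal-child = child
  ; internal-degree = degree≥2
  ; leaf-tree-nbr = leaf-tree-nbr
  ; no-leaf-leaf = λ m a∈ls _ → Inv.leaf-childless a∈ls m }
  where
  open BelowRoot (t ∷ u ∷ us)
  child : ∀ v → v < n → v ∉ ls → ∃ λ c → (v , c) ∈ es
  child zero _ _ = 1 , firstChildEdge 0 1 t (u ∷ us)
  child (suc v) = internal-child v
  degree≥2 : ∀ v → v < n → v ∉ ls → 2 ≤ degree es v
  degree≥2 zero _ _ with secondChildEdge 0 1 t u us
  ... | c , 1<c , mc = two-edges⇒2≤degree es 0 (firstChildEdge 0 1 t (u ∷ us)) mc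
        (incident-src 0 1) (incident-src 0 c) (λ e → <-irrefl (cong proj₂ e) 1<c)
  degree≥2 (suc v) = internal-degree v

-- If the root has a single child (the vertex 1), the root is itself a leaf,
-- first on the leaf cycle.  With at least three vertices, 1 is not a leaf.
frame-pendantRoot : ∀ t → let open BelowRoot (t ∷ []) in 3 ≤ n → HalinFrame n es (0 ∷ ls)
frame-pendantRoot t 3≤n = record
  { edge-bounds = edge-bounds
  ; parents-unique = Inv.parents-unique
  ; leaf-bound = λ { (here refl) → Inv.k≤next ; (there m) → proj₂ (Inv.leaf-bounds m) }
  ; leaves-unique = ¬Any⇒All¬ ls (λ m → <-irrefl refl (proj₁ (Inv.leaf-bounds m))) ∷ Inv.leaves-unique
  ; internal-child = child
  ; internal-degree = degree≥2
  ; leaf-tree-nbr = λ { (here refl) x y → trans (root-nbr x) (sym (root-nbr y))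
                      ; (there v∈ls) → leaf-tree-nbr v∈ls }
  ; no-leaf-leaf = no-leaf-leaf }
  where
  open BelowRoot (t ∷ [])
  child : ∀ v → v < n → v ∉ 0 ∷ ls → ∃ λ c → (v , c) ∈ es
  child zero _ v∉ = ⊥-elim (v∉ (here refl))
  child (suc v) v<n v∉ = internal-child v v<n (v∉ ∘ there)
  degree≥2 : ∀ v → v < n → v ∉ 0 ∷ ls → 2 ≤ degree es v
  degree≥2 zero _ v∉ = ⊥-elim (v∉ (here refl))
  degree≥2 (suc v) v<n v∉ = internal-degree v v<n (v∉ ∘ there)
  root-nbr : ∀ {w} → TreeAdj es 0 w → w ≡ 1
  root-nbr (inj₁ m) = onlyChild 0 1 t z<s m
  root-nbr (inj₂ m) = ⊥-elim (<-irrefl refl (≤-<-trans z≤n (proj₁ (edge-bounds m))))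
  -- vertex 2 exists; its parent lies in [0 , 2) and is not the root, so it is 1
  one-internal : 1 ∉ ls
  one-internal 1∈ls with Inv.has-parent 2 (s≤s z≤n) 3≤n
  ... | a , ma with Inv.edge-bounds ma
  ...   | inj₁ refl , _ = contradiction (onlyChild 0 1 t z<s ma) λ ()
  ...   | inj₂ 1≤a , a<2 , _ with ≤-antisym (≤-pred a<2) 1≤a
  ...     | refl = Inv.leaf-childless 1∈ls ma
  no-leaf-leaf : ∀ {a b} → (a , b) ∈ es → a ∈ 0 ∷ ls → b ∈ 0 ∷ ls → ⊥
  no-leaf-leaf m (there a∈ls) _ = Inv.leaf-childless a∈ls m
  no-leaf-leaf m (here refl) b∈ with onlyChild 0 1 t z<s m | b∈
  ... | refl | there 1∈ls = one-internal 1∈ls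

halinFrame : (T : PTree) → 3 ≤ order T → HalinFrame (order T) (treeEdges T) (leafOrder T)
halinFrame (node []) (s≤s ())
halinFrame (node (t ∷ [])) 3≤n = frame-pendantRoot t 3≤n
halinFrame (node (t ∷ u ∷ us)) _ = frame-branchingRoot t u us

pathEdges : ℕ → List ℕ → List (ℕ × ℕ)
pathEdges f [] = []
pathEdges f (x ∷ []) = (x , f) ∷ []
pathEdges f (x ∷ y ∷ xs) = (x , y) ∷ pathEdges f (y ∷ xs)

cycleTail≡pathEdges : ∀ f y ys → drop 1 (cycleEdges (f ∷ y ∷ ys)) ≡ pathEdges f (y ∷ ys)
cycleTail≡pathEdges f y [] = refl
cycleTail≡pathEdges f y (z ∷ zs) = cong ((y , z) ∷_) (cycleTail≡pathEdges f z zs)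

cycleEdges≡pathEdges : ∀ l ls → cycleEdges (l ∷ ls) ≡ pathEdges l (l ∷ ls)
cycleEdges≡pathEdges l [] = refl
cycleEdges≡pathEdges l (y ∷ ys) = cong ((l , y) ∷_) (cycleTail≡pathEdges l y ys)

path-source : ∀ f xs {a b} → (a , b) ∈ pathEdges f xs → a ∈ xs
path-source f (x ∷ []) (here refl) = here refl
path-source f (x ∷ y ∷ xs) (here refl) = here refl
path-source f (x ∷ y ∷ xs) (there m) = there (path-source f (y ∷ xs) m)

path-target : ∀ f x xs {a b} → (a , b) ∈ pathEdges f (x ∷ xs) → b ∈ xs ⊎ b ≡ f
path-target f x [] (here refl) = inj₂ refl
path-target f x (y ∷ xs) (here refl) = inj₁ (here refl)
path-target f x (y ∷ xs) (there m) = [ inj₁ ∘ there , inj₂ ]′ (path-target f y xs m)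

path-functional : ∀ f xs → Unique xs → ∀ {a b b′} →
  (a , b) ∈ pathEdges f xs → (a , b′) ∈ pathEdges f xs → b ≡ b′
path-functional f (x ∷ []) _ (here refl) (here refl) = refl
path-functional f (x ∷ y ∷ xs) _ (here refl) (here refl) = refl
path-functional f (x ∷ y ∷ xs) u (here refl) (there m) = ⊥-elim (head∉tail u (path-source f (y ∷ xs) m))
path-functional f (x ∷ y ∷ xs) u (there m) (here refl) = ⊥-elim (head∉tail u (path-source f (y ∷ xs) m))
path-functional f (x ∷ y ∷ xs) (_ ∷ u) (there m) (there m′) = path-functional f (y ∷ xs) u m m′

path-injective : ∀ f x xs → Unique (x ∷ xs) → f ∉ xs → ∀ {a a′ b} →
  (a , b) ∈ pathEdges f (x ∷ xs) → (a′ , b) ∈ pathEdges f (x ∷ xs) → a ≡ a′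
path-injective f x [] _ _ (here refl) (here refl) = refl
path-injective f x (y ∷ xs) _ _ (here refl) (here refl) = refl
path-injective f x (y ∷ xs) (_ ∷ u) f∉ (here refl) (there m) with path-target f y xs m
... | inj₁ y∈xs = ⊥-elim (head∉tail u y∈xs)
... | inj₂ refl = ⊥-elim (f∉ (here refl))
path-injective f x (y ∷ xs) (_ ∷ u) f∉ (there m) (here refl) with path-target f y xs m
... | inj₁ y∈xs = ⊥-elim (head∉tail u y∈xs)
... | inj₂ refl = ⊥-elim (f∉ (here refl))
path-injective f x (y ∷ xs) (_ ∷ u) f∉ (there m) (there m′) = path-injective f y xs u (f∉ ∘ there) m m′

lastOf : ℕ → List ℕ → ℕ
lastOf x [] = x
lastOf x (y ∷ ys) = lastOf y ys

lastOf-∈ : ∀ x xs → lastOf x xs ∈ x ∷ xs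
lastOf-∈ x [] = here refl
lastOf-∈ x (y ∷ ys) = there (lastOf-∈ y ys)

path-closing : ∀ f x xs → (lastOf x xs , f) ∈ pathEdges f (x ∷ xs)
path-closing f x [] = here refl
path-closing f x (y ∷ ys) = there (path-closing f y ys)

indicator : ∀ {X : Set} → Dec X → Fin 2
indicator (yes _) = fsuc fzero
indicator (no _) = fzero

indicator-transfer : ∀ {X Y : Set} (d : Dec X) (d′ : Dec Y) → indicator d ≡ indicator d′ → X → Y
indicator-transfer (yes _) (yes y) _ _ = y
indicator-transfer (no ¬x) _ _ x = ⊥-elim (¬x x)

vertex : ∀ {n v} → v < n → Fin n
vertex p = fromℕ< p

toℕ-vertex : ∀ {n v} (p : v < n) → toℕ (vertex p) ≡ v
toℕ-vertex p = toℕ-fromℕ< p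

module HalinGraph {n : ℕ} {TE : List (ℕ × ℕ)} {l₀ : ℕ} {ls : List ℕ}
                  (F : HalinFrame n TE (l₀ ∷ ls)) where
  open HalinFrame F

  L : List ℕ
  L = l₀ ∷ ls

  E : List (ℕ × ℕ)
  E = TE ++ cycleEdges L

  Succ : ℕ → ℕ → Set
  Succ a b = (a , b) ∈ cycleEdges L

  succ⇒path : ∀ {a b} → Succ a b → (a , b) ∈ pathEdges l₀ L
  succ⇒path {a} {b} = subst ((a , b) ∈_) (cycleEdges≡pathEdges l₀ ls)

  path⇒succ : ∀ {a b} → (a , b) ∈ pathEdges l₀ L → Succ a b
  path⇒succ {a} {b} = subst ((a , b) ∈_) (sym (cycleEdges≡pathEdges l₀ ls))

  succ-functional : ∀ {a b b′} → Succ a b → Succ a b′ → b ≡ b′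
  succ-functional s s′ = path-functional l₀ L leaves-unique (succ⇒path s) (succ⇒path s′)

  succ-injective : ∀ {a a′ b} → Succ a b → Succ a′ b → a ≡ a′
  succ-injective s s′ =
    path-injective l₀ l₀ ls leaves-unique (head∉tail leaves-unique) (succ⇒path s) (succ⇒path s′)

  succ-leaves : ∀ {a b} → Succ a b → a ∈ L × b ∈ L
  succ-leaves s = path-source l₀ L (succ⇒path s) ,
                  [ there , (λ { refl → here refl }) ]′ (path-target l₀ l₀ ls (succ⇒path s))

  -- Adjacency in G between labels;  Adj n E u v  unfolds to  AdjN (toℕ u) (toℕ v).
  AdjN : ℕ → ℕ → Set
  AdjN x y = (x , y) ∈ E ⊎ (y , x) ∈ E

  Link : ℕ → ℕ → Set
  Link x y = TreeAdj TE x y ⊎ Succ x y ⊎ Succ y x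

  adj⇒link : ∀ {x y} → AdjN x y → Link x y
  adj⇒link (inj₁ m) = [ inj₁ ∘ inj₁ , inj₂ ∘ inj₁ ]′ (∈-++⁻ TE m)
  adj⇒link (inj₂ m) = [ inj₁ ∘ inj₂ , inj₂ ∘ inj₂ ]′ (∈-++⁻ TE m)

  tree⇒adj : ∀ {x y} → TreeAdj TE x y → AdjN x y
  tree⇒adj = [ inj₁ ∘ ∈-++⁺ˡ , inj₂ ∘ ∈-++⁺ˡ ]′

  succ⇒adj : ∀ {x y} → Succ x y → AdjN x y
  succ⇒adj s = inj₁ (∈-++⁺ʳ TE s)

  pred⇒adj : ∀ {x y} → Succ y x → AdjN x y
  pred⇒adj s = inj₂ (∈-++⁺ʳ TE s)

  leaves-adj⇒cycle : ∀ {x y} → x ∈ L → y ∈ L → AdjN x y → Succ x y ⊎ Succ y x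
  leaves-adj⇒cycle x∈L y∈L a with adj⇒link a
  ... | inj₁ (inj₁ t) = ⊥-elim (no-leaf-leaf t x∈L y∈L)
  ... | inj₁ (inj₂ t) = ⊥-elim (no-leaf-leaf t y∈L x∈L)
  ... | inj₂ s = s

  FourNeighbours : Fin n → Set
  FourNeighbours u = Σ (Fin 4 → Fin n) λ e → (∀ i j → e i ≡ e j → i ≡ j) × (∀ i → Adj n E u (e i))

  linkKind : ∀ {x y} → Link x y → Fin 3
  linkKind (inj₁ _) = fzero
  linkKind (inj₂ (inj₁ _)) = fsuc fzero
  linkKind (inj₂ (inj₂ _)) = fsuc (fsuc fzero)

  linkKind-determines : ∀ {x y₁ y₂} → x ∈ L → (k₁ : Link x y₁) (k₂ : Link x y₂) →
    linkKind k₁ ≡ linkKind k₂ → y₁ ≡ y₂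
  linkKind-determines x∈L (inj₁ t₁) (inj₁ t₂) _ = leaf-tree-nbr x∈L t₁ t₂
  linkKind-determines x∈L (inj₂ (inj₁ s₁)) (inj₂ (inj₁ s₂)) _ = succ-functional s₁ s₂
  linkKind-determines x∈L (inj₂ (inj₂ s₁)) (inj₂ (inj₂ s₂)) _ = succ-injective s₁ s₂
  linkKind-determines x∈L (inj₁ _) (inj₂ (inj₁ _)) ()
  linkKind-determines x∈L (inj₁ _) (inj₂ (inj₂ _)) ()
  linkKind-determines x∈L (inj₂ (inj₁ _)) (inj₁ _) ()
  linkKind-determines x∈L (inj₂ (inj₁ _)) (inj₂ (inj₂ _)) ()
  linkKind-determines x∈L (inj₂ (inj₂ _)) (inj₁ _) ()
  linkKind-determines x∈L (inj₂ (inj₂ _)) (inj₂ (inj₁ _)) ()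

  -- A leaf has at most three neighbours (pigeonhole on the kinds of links).
  leaf-fewNeighbours : ∀ u → toℕ u ∈ L → ¬ FourNeighbours u
  leaf-fewNeighbours u u∈L (e , e-inj , e-adj)
    with pigeonhole ≤-refl (λ i → linkKind (adj⇒link (e-adj i)))
  ... | i , j , i<j , same-kind = <-irrefl (cong toℕ i≡j) i<j
    where
    i≡j : i ≡ j
    i≡j = e-inj i j (toℕ-injective (linkKind-determines u∈L _ _ same-kind))

  fourNeighbours-fromList : ∀ u (ws : List ℕ) → 4 ≤ length ws → Unique ws →
    (∀ {w} → w ∈ ws → w < n × AdjN (toℕ u) w) → FourNeighbours u
  fourNeighbours-fromList u (w₀ ∷ w₁ ∷ w₂ ∷ w₃ ∷ rest) _
    ((≢₀₁ ∷ ≢₀₂ ∷ ≢₀₃ ∷ _) ∷ (≢₁₂ ∷ ≢₁₃ ∷ _) ∷ (≢₂₃ ∷ _) ∷ _) nbr = e , e-inj , e-adj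
    where
    w : Vec ℕ 4
    w = w₀ ∷ w₁ ∷ w₂ ∷ w₃ ∷ []
    w-unique : UniqueVec w
    w-unique = (≢₀₁ ∷ ≢₀₂ ∷ ≢₀₃ ∷ []) ∷ (≢₁₂ ∷ ≢₁₃ ∷ []) ∷ (≢₂₃ ∷ []) ∷ [] ∷ []
    w-member : ∀ i → lookup w i ∈ w₀ ∷ w₁ ∷ w₂ ∷ w₃ ∷ rest
    w-member fzero = here refl
    w-member (fsuc fzero) = there (here refl)
    w-member (fsuc (fsuc fzero)) = there (there (here refl))
    w-member (fsuc (fsuc (fsuc fzero))) = there (there (there (here refl)))
    bound : ∀ i → lookup w i < n
    bound i = proj₁ (nbr (w-member i))
    e : Fin 4 → Fin n
    e i = vertex (bound i)
    e-inj : ∀ i j → e i ≡ e j → i ≡ j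
    e-inj i j eq = lookup-injective w-unique i j
      (trans (sym (toℕ-vertex (bound i))) (trans (cong toℕ eq) (toℕ-vertex (bound j))))
    e-adj : ∀ i → Adj n E u (e i)
    e-adj i = subst (AdjN (toℕ u)) (sym (toℕ-vertex (bound i))) (proj₂ (nbr (w-member i)))
  fourNeighbours-fromList u [] () _ _
  fourNeighbours-fromList u (_ ∷ []) (s≤s ()) _ _
  fourNeighbours-fromList u (_ ∷ _ ∷ []) (s≤s (s≤s ())) _ _
  fourNeighbours-fromList u (_ ∷ _ ∷ _ ∷ []) (s≤s (s≤s (s≤s ()))) _ _

  other : ℕ → ℕ × ℕ → ℕ
  other v (a , b) with a ≟ v
  ... | yes _ = b
  ... | no _ = a

  other-nbr : ∀ v {e} → e ∈ TE → T (incident v e) → TreeAdj TE v (other v e) × other v e < n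
  other-nbr v {a , b} m i with a ≟ v | incident-cases i
  ... | yes refl | _ = inj₁ m , proj₂ (edge-bounds m)
  ... | no a≢v | inj₁ a≡v = ⊥-elim (a≢v a≡v)
  ... | no _ | inj₂ refl = inj₂ m , <-trans (proj₁ (edge-bounds m)) (proj₂ (edge-bounds m))

  other-injective : ∀ v {e e′} → e ∈ TE → e′ ∈ TE → T (incident v e) → T (incident v e′) →
    other v e ≡ other v e′ → e ≡ e′
  other-injective v {a , b} {a′ , b′} m m′ i i′ with a ≟ v | a′ ≟ v | incident-cases i | incident-cases i′
  ... | yes refl | yes refl | _ | _ = proj₂-determines TE parents-unique m m′
  ... | yes refl | no a′≢v | _ | inj₁ a′≡v = ⊥-elim (a′≢v a′≡v)
  ... | yes refl | no _ | _ | inj₂ refl = λ b≡a′ →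
        ⊥-elim (<-asym (proj₁ (edge-bounds m)) (subst (_< v) (sym b≡a′) (proj₁ (edge-bounds m′))))
  ... | no a≢v | _ | inj₁ a≡v | _ = ⊥-elim (a≢v a≡v)
  ... | no _ | yes refl | inj₂ refl | _ = λ a≡b′ →
        ⊥-elim (<-asym (proj₁ (edge-bounds m′)) (subst (_< v) a≡b′ (proj₁ (edge-bounds m))))
  ... | no _ | no a′≢v | inj₂ _ | inj₁ a′≡v = ⊥-elim (a′≢v a′≡v)
  ... | no _ | no _ | inj₂ refl | inj₂ refl = λ _ → proj₂-determines TE parents-unique m m′ refl

  fourNeighbours-ofDegree : ∀ u → 4 ≤ degree TE (toℕ u) → FourNeighbours u
  fourNeighbours-ofDegree u deg =
    fourNeighbours-fromList u (map (other v) es) (subst (4 ≤_) (sym (length-map (other v) es)) deg)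
      (unique-map-on (other v) other-inj (Unique.map⁻ (unique-proj₂-filter P? TE parents-unique))) nbr
    where
    v : ℕ
    v = toℕ u
    P? : (e : ℕ × ℕ) → Dec (T (incident v e))
    P? = T? ∘ incident v
    es : List (ℕ × ℕ)
    es = filter P? TE
    other-inj : ∀ {e e′} → e ∈ es → e′ ∈ es → other v e ≡ other v e′ → e ≡ e′
    other-inj m m′ = let (m₁ , i₁) = ∈-filter⁻ P? m ; (m₂ , i₂) = ∈-filter⁻ P? m′ in
                     other-injective v m₁ m₂ i₁ i₂
    nbr : ∀ {w} → w ∈ map (other v) es → w < n × AdjN v w
    nbr m with ∈-map⁻ (other v) m
    ... | e , e∈es , refl = let (tree-adj , bound) = uncurry (other-nbr v) (∈-filter⁻ P? e∈es) in
                            bound , tree⇒adj tree-adj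

  module Automorphism (π : Permutation′ n) (aut : IsAutomorphism n E π) where
    σ : Fin n → Fin n
    σ u = π ⟨$⟩ʳ u

    σ-injective : ∀ {a b} → σ a ≡ σ b → a ≡ b
    σ-injective eq = trans (sym (inverseˡ π)) (trans (cong (π ⟨$⟩ˡ_) eq) (inverseˡ π))

    σ-label-injective : ∀ {a b} → toℕ (σ a) ≡ toℕ (σ b) → toℕ a ≡ toℕ b
    σ-label-injective = cong toℕ ∘ σ-injective ∘ toℕ-injective

    σ-adj : ∀ {a b} → Adj n E a b → Adj n E (σ a) (σ b)
    σ-adj {a} {b} = Equivalence.to (aut a b)

    σ-adj⁻ : ∀ {a b} → Adj n E (σ a) (σ b) → Adj n E a b
    σ-adj⁻ {a} {b} = Equivalence.from (aut a b)

    fourNeighbours-reflected : ∀ {u} → FourNeighbours (σ u) → FourNeighbours u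
    fourNeighbours-reflected {u} (e , e-inj , e-adj) =
      (λ i → π ⟨$⟩ˡ e i) ,
      (λ i j eq → e-inj i j (trans (sym (inverseʳ π)) (trans (cong σ eq) (inverseʳ π)))) ,
      (λ i → σ-adj⁻ (subst (Adj n E (σ u)) (sym (inverseʳ π)) (e-adj i)))

    Fixes : ℕ → Set
    Fixes v = ∀ f → toℕ f ≡ v → σ f ≡ f

    fixes-byLabel : ∀ {v} (p : v < n) → toℕ (σ (vertex p)) ≡ v → Fixes v
    fixes-byLabel p eq f f≡v with toℕ-injective (trans f≡v (sym (toℕ-vertex p)))
    ... | refl = toℕ-injective (trans eq (sym f≡v))

    fixed-label : ∀ {v} → Fixes v → (p : v < n) → toℕ (σ (vertex p)) ≡ v
    fixed-label fix p = trans (cong toℕ (fix (vertex p) (toℕ-vertex p))) (toℕ-vertex p)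

    -- Downward induction on labels:
    -- an internal f has a child c > f, fixed by induction, so σ f is adjacent
    -- to c.  Either σ f is c's unique parent f, or σ f is a child of c or a
    -- cycle neighbour of the leaf c – a vertex already known to be fixed, so
    -- σ (σ f) = σ f and injectivity gives σ f = f.
    identity-ifLeavesFixed : (∀ {v} → v ∈ L → Fixes v) → ∀ f → σ f ≡ f
    identity-ifLeavesFixed leaf-fixed = WF.All.wfRec >-wellFounded _ (λ f → σ f ≡ f) step
      where
      step : ∀ f → (∀ {g} → g Fin.> f → σ g ≡ g) → σ f ≡ f
      step f IH with toℕ f ∈? L
      ... | yes f∈L = leaf-fixed f∈L f refl
      ... | no f∉L with internal-child (toℕ f) (toℕ<n f) f∉L
      ...   | c , f→c = image-is-f (adj⇒link σf~c)
        where
        pc : c < n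
        pc = proj₂ (edge-bounds f→c)
        c-fixed : σ (vertex pc) ≡ vertex pc
        c-fixed = IH {vertex pc} (subst (toℕ f <_) (sym (toℕ-vertex pc)) (proj₁ (edge-bounds f→c)))
        σf~c : AdjN (toℕ (σ f)) c
        σf~c = subst (AdjN (toℕ (σ f))) (trans (cong toℕ c-fixed) (toℕ-vertex pc))
                 (σ-adj (subst (AdjN (toℕ f)) (sym (toℕ-vertex pc)) (tree⇒adj (inj₁ f→c))))
        image-is-f : Link (toℕ (σ f)) c → σ f ≡ f
        image-is-f (inj₁ (inj₁ σf→c)) =
          toℕ-injective (cong proj₁ (proj₂-determines TE parents-unique σf→c f→c refl))
        image-is-f (inj₁ (inj₂ c→σf)) =
          σ-injective (IH {σ f} (<-trans (proj₁ (edge-bounds f→c)) (proj₁ (edge-bounds c→σf))))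
        image-is-f (inj₂ (inj₁ σf→c)) = σ-injective (leaf-fixed (proj₁ (succ-leaves σf→c)) (σ f) refl)
        image-is-f (inj₂ (inj₂ c→σf)) = σ-injective (leaf-fixed (proj₂ (succ-leaves c→σf)) (σ f) refl)

    module LargeDegrees (degree≥4 : ∀ (u : Fin n) → toℕ u ∉ L → 4 ≤ degree TE (toℕ u)) where
      -- σ maps leaves to leaves: a leaf has no four distinct neighbours.
      leaf-preserved : ∀ u → toℕ u ∈ L → toℕ (σ u) ∈ L
      leaf-preserved u u∈L with toℕ (σ u) ∈? L
      ... | yes σu∈L = σu∈L
      ... | no σu∉L = ⊥-elim (leaf-fewNeighbours u u∈L
                        (fourNeighbours-reflected (fourNeighbours-ofDegree (σ u) (degree≥4 (σ u) σu∉L))))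

      -- If σ fixes consecutive leaves a → b, it fixes the successor c ≠ a of
      -- b: σ c is a leaf adjacent to σ b = b, so it is c or a = σ a.
      fixes-next : ∀ {a b c} → Succ a b → Succ b c → a ≢ c → Fixes a → Fixes b → Fixes c
      fixes-next {a} {b} {c} a→b b→c a≢c fix-a fix-b f f≡c =
        image-is-f (leaves-adj⇒cycle (proj₁ (succ-leaves b→c)) σf∈L b~σf)
        where
        pa : a < n
        pa = leaf-bound (proj₁ (succ-leaves a→b))
        pb : b < n
        pb = leaf-bound (proj₁ (succ-leaves b→c))
        σf∈L : toℕ (σ f) ∈ L
        σf∈L = leaf-preserved f (subst (_∈ L) (sym f≡c) (proj₂ (succ-leaves b→c)))
        b~σf : AdjN b (toℕ (σ f))
        b~σf = subst (λ x → AdjN x (toℕ (σ f))) (fixed-label fix-b pb)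
                 (σ-adj (subst₂ AdjN (sym (toℕ-vertex pb)) (sym f≡c) (succ⇒adj b→c)))
        image-is-f : Succ b (toℕ (σ f)) ⊎ Succ (toℕ (σ f)) b → σ f ≡ f
        image-is-f (inj₁ b→σf) = toℕ-injective (trans (sym (succ-functional b→c b→σf)) (sym f≡c))
        image-is-f (inj₂ σf→b) = ⊥-elim (a≢c (trans (sym (toℕ-vertex pa)) (trans a≡f f≡c)))
          where
          a≡f : toℕ (vertex pa) ≡ toℕ f
          a≡f = σ-label-injective (trans (fixed-label fix-a pa) (sym (succ-injective σf→b a→b)))

      fixes-along : ∀ a b ys → (∀ {e} → e ∈ pathEdges l₀ (a ∷ b ∷ ys) → e ∈ pathEdges l₀ L) →
        Unique (a ∷ b ∷ ys) → Fixes a → Fixes b → All Fixes ys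
      fixes-along a b [] _ _ _ _ = []
      fixes-along a b (c ∷ ys) sub ((_ ∷ a≢c ∷ _) ∷ u) fix-a fix-b =
        fix-c ∷ fixes-along b c ys (sub ∘ there) u fix-b fix-c
        where
        fix-c : Fixes c
        fix-c = fixes-next (path⇒succ (sub (here refl))) (path⇒succ (sub (there (here refl)))) a≢c fix-a fix-b

module Colouring {n : ℕ} {TE : List (ℕ × ℕ)} (l₀ l₁ l₂ l₃ l₄ l₅ : ℕ) (rest : List ℕ)
                 (F : HalinFrame n TE (l₀ ∷ l₁ ∷ l₂ ∷ l₃ ∷ l₄ ∷ l₅ ∷ rest))
                 (degree≥4 : ∀ (u : Fin n) → toℕ u ∉ l₀ ∷ l₁ ∷ l₂ ∷ l₃ ∷ l₄ ∷ l₅ ∷ rest →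
                             4 ≤ degree TE (toℕ u)) where
  open HalinFrame F
  open HalinGraph F

  at₀ : l₀ ∈ L
  at₀ = here refl
  at₁ : l₁ ∈ L
  at₁ = there (here refl)
  at₂ : l₂ ∈ L
  at₂ = there (there (here refl))
  at₃ : l₃ ∈ L
  at₃ = there (there (there (here refl)))
  at₄ : l₄ ∈ L
  at₄ = there (there (there (there (here refl))))

  last : ℕ
  last = lastOf l₅ rest

  atLast : last ∈ L
  atLast = there (there (there (there (there (lastOf-∈ l₅ rest)))))

  differ : ∀ {x y} (p : x ∈ L) (q : y ∈ L) → index p ≢ index q → x ≢ y
  differ = unique-distinct leaves-unique

  step₀₁ : Succ l₀ l₁
  step₀₁ = path⇒succ (here refl)
  step₁₂ : Succ l₁ l₂
  step₁₂ = path⇒succ (there (here refl))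
  step₂₃ : Succ l₂ l₃
  step₂₃ = path⇒succ (there (there (here refl)))
  step₃₄ : Succ l₃ l₄
  step₃₄ = path⇒succ (there (there (there (here refl))))
  stepLast : Succ last l₀
  stepLast = path⇒succ (path-closing l₀ l₀ (l₁ ∷ l₂ ∷ l₃ ∷ l₄ ∷ l₅ ∷ rest))

  leafVertex : ∀ {v} → v ∈ L → Fin n
  leafVertex m = vertex (leaf-bound m)

  toℕ-leafVertex : ∀ {v} (m : v ∈ L) → toℕ (leafVertex m) ≡ v
  toℕ-leafVertex m = toℕ-vertex (leaf-bound m)

  Marked : ℕ → Set
  Marked x = x ≡ l₀ ⊎ x ≡ l₁ ⊎ x ≡ l₃

  marked? : ∀ x → Dec (Marked x)
  marked? x = x ≟ l₀ ⊎-dec x ≟ l₁ ⊎-dec x ≟ l₃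

  φ : Fin n → Fin 2
  φ u = indicator (marked? (toℕ u))

  marked-leaf : ∀ {x} → Marked x → x ∈ L
  marked-leaf = [ (λ { refl → at₀ }) , [ (λ { refl → at₁ }) , (λ { refl → at₃ }) ]′ ]′

  unmarked₂ : ¬ Marked l₂
  unmarked₂ = [ differ at₂ at₀ (λ ()) , [ differ at₂ at₁ (λ ()) , differ at₂ at₃ (λ ()) ]′ ]′

  unmarked₄ : ¬ Marked l₄
  unmarked₄ = [ differ at₄ at₀ (λ ()) , [ differ at₄ at₁ (λ ()) , differ at₄ at₃ (λ ()) ]′ ]′

  -- l₃ is the marked vertex without marked neighbours: its neighbours on the
  -- cycle are l₂ and l₄.
  l₃-unmarkedNbrs : ∀ {y} → Marked y → ¬ AdjN l₃ y
  l₃-unmarkedNbrs my a with leaves-adj⇒cycle at₃ (marked-leaf my) a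
  ... | inj₁ l₃→y = unmarked₄ (subst Marked (sym (succ-functional step₃₄ l₃→y)) my)
  ... | inj₂ y→l₃ = unmarked₂ (subst Marked (succ-injective y→l₃ step₂₃) my)

  module Preserving (π : Permutation′ n) (aut : IsAutomorphism n E π)
                    (preserves : ∀ v → φ (π ⟨$⟩ʳ v) ≡ φ v) where
    open Automorphism π aut
    open LargeDegrees degree≥4

    marked-image : ∀ u → Marked (toℕ u) → Marked (toℕ (σ u))
    marked-image u = indicator-transfer (marked? (toℕ u)) (marked? (toℕ (σ u))) (sym (preserves u))

    marked-preimage : ∀ u → Marked (toℕ (σ u)) → Marked (toℕ u)
    marked-preimage u = indicator-transfer (marked? (toℕ (σ u))) (marked? (toℕ u)) (preserves u)

    σ-leaves-distinct : ∀ {x y} (p : x ∈ L) (q : y ∈ L) →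
      toℕ (σ (leafVertex p)) ≡ toℕ (σ (leafVertex q)) → x ≡ y
    σ-leaves-distinct p q eq = trans (sym (toℕ-leafVertex p)) (trans (σ-label-injective eq) (toℕ-leafVertex q))

    σl₃-unmarkedNbrs : ∀ {y} → Marked y → ¬ AdjN (toℕ (σ (leafVertex at₃))) y
    σl₃-unmarkedNbrs {y} my a =
      l₃-unmarkedNbrs (marked-preimage z (subst Marked (sym σz≡y) my))
        (subst₂ AdjN (toℕ-leafVertex at₃) refl (σ-adj⁻ (subst (AdjN _) (sym σz≡y) a)))
      where
      py : y < n
      py = leaf-bound (marked-leaf my)
      z : Fin n
      z = π ⟨$⟩ˡ vertex py
      σz≡y : toℕ (σ z) ≡ y
      σz≡y = trans (cong toℕ (inverseʳ π)) (toℕ-vertex py)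

    -- σ l₃ is marked, and it is neither l₀ nor l₁, which are adjacent.
    σl₃ : toℕ (σ (leafVertex at₃)) ≡ l₃
    σl₃ with marked-image (leafVertex at₃) (inj₂ (inj₂ (toℕ-leafVertex at₃)))
    ... | inj₁ ≡l₀ = ⊥-elim (σl₃-unmarkedNbrs (inj₂ (inj₁ refl))
                       (subst (λ x → AdjN x l₁) (sym ≡l₀) (succ⇒adj step₀₁)))
    ... | inj₂ (inj₁ ≡l₁) = ⊥-elim (σl₃-unmarkedNbrs (inj₁ refl)
                              (subst (λ x → AdjN x l₀) (sym ≡l₁) (pred⇒adj step₀₁)))
    ... | inj₂ (inj₂ ≡l₃) = ≡l₃

    -- σ l₁ is marked and differs from σ l₃ = l₃.  Were it l₀, the leaf σ l₂
    -- would be adjacent to l₀ and l₃, but their cycle neighbours {l₁ , last}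
    -- and {l₂ , l₄} are disjoint.
    σl₁ : toℕ (σ (leafVertex at₁)) ≡ l₁
    σl₁ with marked-image (leafVertex at₁) (inj₂ (inj₁ (toℕ-leafVertex at₁)))
    ... | inj₂ (inj₁ ≡l₁) = ≡l₁
    ... | inj₂ (inj₂ ≡l₃) = ⊥-elim (differ at₁ at₃ (λ ()) (σ-leaves-distinct at₁ at₃ (trans ≡l₃ (sym σl₃))))
    ... | inj₁ ≡l₀ = ⊥-elim (no-common-nbr (leaves-adj⇒cycle at₀ y∈L l₀~y) (leaves-adj⇒cycle y∈L at₃ y~l₃))
      where
      y : ℕ
      y = toℕ (σ (leafVertex at₂))
      y∈L : y ∈ L
      y∈L = leaf-preserved (leafVertex at₂) (subst (_∈ L) (sym (toℕ-leafVertex at₂)) at₂)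
      l₀~y : AdjN l₀ y
      l₀~y = subst (λ x → AdjN x y) ≡l₀
        (σ-adj (subst₂ AdjN (sym (toℕ-leafVertex at₁)) (sym (toℕ-leafVertex at₂)) (succ⇒adj step₁₂)))
      y~l₃ : AdjN y l₃
      y~l₃ = subst (AdjN y) σl₃
        (σ-adj (subst₂ AdjN (sym (toℕ-leafVertex at₂)) (sym (toℕ-leafVertex at₃)) (succ⇒adj step₂₃)))
      no-common-nbr : Succ l₀ y ⊎ Succ y l₀ → Succ y l₃ ⊎ Succ l₃ y → ⊥
      no-common-nbr (inj₁ s) (inj₁ t) =
        differ at₁ at₂ (λ ()) (trans (succ-functional step₀₁ s) (sym (succ-injective step₂₃ t)))
      no-common-nbr (inj₁ s) (inj₂ t) =
        differ at₁ at₄ (λ ()) (trans (succ-functional step₀₁ s) (sym (succ-functional step₃₄ t)))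
      no-common-nbr (inj₂ s) (inj₁ t) =
        differ atLast at₂ (λ ()) (trans (succ-injective stepLast s) (sym (succ-injective step₂₃ t)))
      no-common-nbr (inj₂ s) (inj₂ t) =
        differ atLast at₄ (λ ()) (trans (succ-injective stepLast s) (sym (succ-functional step₃₄ t)))

    σl₀ : toℕ (σ (leafVertex at₀)) ≡ l₀
    σl₀ with marked-image (leafVertex at₀) (inj₁ (toℕ-leafVertex at₀))
    ... | inj₁ ≡l₀ = ≡l₀
    ... | inj₂ (inj₁ ≡l₁) = ⊥-elim (differ at₀ at₁ (λ ()) (σ-leaves-distinct at₀ at₁ (trans ≡l₁ (sym σl₁))))
    ... | inj₂ (inj₂ ≡l₃) = ⊥-elim (differ at₀ at₃ (λ ()) (σ-leaves-distinct at₀ at₃ (trans ≡l₃ (sym σl₃))))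

    fixes₀ : Fixes l₀
    fixes₀ = fixes-byLabel (leaf-bound at₀) σl₀

    fixes₁ : Fixes l₁
    fixes₁ = fixes-byLabel (leaf-bound at₁) σl₁

    leaf-fixed : ∀ {v} → v ∈ L → Fixes v
    leaf-fixed (here refl) = fixes₀
    leaf-fixed (there (here refl)) = fixes₁
    leaf-fixed (there (there m)) = All.lookup (fixes-along l₀ l₁ _ (λ e → e) leaves-unique fixes₀ fixes₁) m

  distinguishing : IsDistinguishing n E 2 φ
  distinguishing π aut preserves =
    Automorphism.identity-ifLeavesFixed π aut (Preserving.leaf-fixed π aut preserves)

internal-degree≥4 : ∀ {n TE L} → HalinFrame n TE L →
  (∀ (v : Fin n) → ¬ (degree TE (toℕ v) ≡ 2)) → (∀ (v : Fin n) → ¬ (degree TE (toℕ v) ≡ 3)) →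
  ∀ (u : Fin n) → toℕ u ∉ L → 4 ≤ degree TE (toℕ u)
internal-degree≥4 F no2 no3 u u∉L with m≤n⇒m<n∨m≡n (HalinFrame.internal-degree F (toℕ u) (toℕ<n u) u∉L)
... | inj₂ 2≡d = ⊥-elim (no2 u (sym 2≡d))
... | inj₁ 2<d with m≤n⇒m<n∨m≡n 2<d
...   | inj₂ 3≡d = ⊥-elim (no3 u (sym 3≡d))
...   | inj₁ 3<d = 3<d

-- Vertices of tree degree 1 are leaves (internal ones have degree ≥ 2), so
-- there are at most  length L  of them.
degreeOne-count≤ : ∀ {n TE L} → HalinFrame n TE L →
  length (filter (λ v → degree TE (toℕ v) ≟ 1) (allFin n)) ≤ length L
degreeOne-count≤ {n} {TE} {L} F =
  subst (_≤ length L) (length-map toℕ ones)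
    (unique⊆⇒length≤ (map toℕ ones) L
      (Unique.map⁺ toℕ-injective (Unique.filter⁺ P? {xs = allFin n} (Unique.allFin⁺ n))) ones⊆L)
  where
  P? : (v : Fin n) → Dec (degree TE (toℕ v) ≡ 1)
  P? v = degree TE (toℕ v) ≟ 1
  ones : List (Fin n)
  ones = filter P? (allFin n)
  ones⊆L : ∀ {z} → z ∈ map toℕ ones → z ∈ L
  ones⊆L m with ∈-map⁻ toℕ m
  ... | v , v∈ones , refl with toℕ v ∈? L
  ...   | yes v∈L = v∈L
  ...   | no v∉L = ⊥-elim (<-irrefl refl (subst (2 ≤_) (proj₂ (∈-filter⁻ P? {xs = allFin n} v∈ones))
                                           (HalinFrame.internal-degree F (toℕ v) (toℕ<n v) v∉L)))

halin-D≤2 : ∀ {n TE L} → HalinFrame n TE L →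
  (∀ (u : Fin n) → toℕ u ∉ L → 4 ≤ degree TE (toℕ u)) → 6 ≤ length L →
  DistNumberAtMost n (TE ++ cycleEdges L) 2
halin-D≤2 {L = l₀ ∷ l₁ ∷ l₂ ∷ l₃ ∷ l₄ ∷ l₅ ∷ rest} F degree≥4 _ =
  2 , ≤-refl , Colouring.φ l₀ l₁ l₂ l₃ l₄ l₅ rest F degree≥4 ,
  Colouring.distinguishing l₀ l₁ l₂ l₃ l₄ l₅ rest F degree≥4
halin-D≤2 {L = []} _ _ ()
halin-D≤2 {L = _ ∷ []} _ _ (s≤s ())
halin-D≤2 {L = _ ∷ _ ∷ []} _ _ (s≤s (s≤s ()))
halin-D≤2 {L = _ ∷ _ ∷ _ ∷ []} _ _ (s≤s (s≤s (s≤s ())))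
halin-D≤2 {L = _ ∷ _ ∷ _ ∷ _ ∷ []} _ _ (s≤s (s≤s (s≤s (s≤s ()))))
halin-D≤2 {L = _ ∷ _ ∷ _ ∷ _ ∷ _ ∷ []} _ _ (s≤s (s≤s (s≤s (s≤s (s≤s ())))))

mainTheorem9 : (T : PTree) → 4 ≤ order T →
    (∀ (v : Fin (order T)) → ¬ (degT T v ≡ 2)) →
    (∀ (v : Fin (order T)) → ¬ (degT T v ≡ 3)) →
    6 ≤ numLeaves T →
    DistNumberAtMost (order T) (halinEdges T) 2
mainTheorem9 T order≥4 no2 no3 leaves≥6 =
  halin-D≤2 frame (internal-degree≥4 frame no2 no3) (≤-trans leaves≥6 (degreeOne-count≤ frame))
  where
  frame : HalinFrame (order T) (treeEdges T) (leafOrder T)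
  frame = halinFrame T (≤-trans (n≤1+n 3) order≥4)
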